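{- Let $G=\langle V,A\rangle$ be a finite directed graph with $n$ vertices. For $v\in V$ let $N^+(v)=\{u\mid vu\in A\}$ and $N^+[v]=N^+(v)\cup\{v\}$. An ordering of the vertices is a bijective labelling $L:V\to\{1,\dots,n\}$, and the representative of $v$ under $L$ is $r_L(v)=\operatorname{argmin}_{w\in N^+[v]}L(w)$. Under $L$, a vertex $v$ is of type 0 if there is no vertex $u$ with $r_L(u)=v$, and of type 1 if there is exactly one vertex $u\in V$ (possibly $u=v$) with $r_L(u)=v$. Fix a vertex $v\in V$ with $N^+(v)\neq\emptyset$. Then the number of labellings $L$ under which $v$ is of type 1 is less than or equal to the number of labellings $L$ under which $v$ is of type 0. -}

module Defs where

open import Data.Nat using (ℕ; zero; suc)
open import Data.Bool using (Bool; true; false)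
open import Data.Fin using (Fin; _≤_; _≤?_; _≟_)
open import Data.Fin.Properties using (all?)
open import Data.Vec using (Vec; []; _∷_; lookup)
open import Data.List using (List; []; _∷_; map; concatMap; filter; length; allFin)
open import Data.Sum using (_⊎_)
open import Relation.Binary.PropositionalEquality using (_≡_)
open import Relation.Nullary using (Dec; yes; no)
open import Relation.Nullary.Decidable using (_→-dec_; _×-dec_; _⊎-dec_)
open import Data.Product using (_×_)
open import Data.Bool.Properties using () renaming (_≟_ to _≟ᵇ_)

Digraph : ℕ → Set
Digraph n = Fin n → Fin n → Bool

InClosedNbhd : ∀ {n} → Digraph n → Fin n → Fin n → Set
InClosedNbhd A u w = (w ≡ u) ⊎ (A u w ≡ true)

inClosedNbhd? : ∀ {n} (A : Digraph n) u w → Dec (InClosedNbhd A u w)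
inClosedNbhd? A u w = (w ≟ u) ⊎-dec (A u w ≟ᵇ true)

-- A labelling L : V → {0,…,n-1}, stored as the vector of labels
-- (L(i) = lookup L i); it is an ordering when it is a bijection,
-- i.e. (as V and the label set are both Fin n) when it is injective.
Labelling : ℕ → Set
Labelling n = Vec (Fin n) n

IsOrdering : ∀ {n} → Labelling n → Set
IsOrdering L = ∀ i j → lookup L i ≡ lookup L j → i ≡ j

isOrdering? : ∀ {n} (L : Labelling n) → Dec (IsOrdering L)
isOrdering? L = all? λ i → all? λ j → (lookup L i ≟ lookup L j) →-dec (i ≟ j)

-- r_L(u) = w : w is the argmin of L over N⁺[u]
-- (unique since L is injective).
IsRep : ∀ {n} → Digraph n → Labelling n → Fin n → Fin n → Set
IsRep A L u w = InClosedNbhd A u w × (∀ x → InClosedNbhd A u x → lookup L w ≤ lookup L x)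

isRep? : ∀ {n} (A : Digraph n) (L : Labelling n) u w → Dec (IsRep A L u w)
isRep? A L u w = inClosedNbhd? A u w ×-dec
  (all? λ x → inClosedNbhd? A u x →-dec (lookup L w ≤? lookup L x))

repCount : ∀ {n} → Digraph n → Labelling n → Fin n → ℕ
repCount A L v = length (filter (λ u → isRep? A L u v) (allFin _))

allVecs : ∀ n k → List (Vec (Fin n) k)
allVecs n zero = [] ∷ []
allVecs n (suc k) = concatMap (λ x → map (x ∷_) (allVecs n k)) (allFin n)

orderings : ∀ n → List (Labelling n)
orderings n = filter isOrdering? (allVecs n n)

Type0 : ∀ {n} → Digraph n → Labelling n → Fin n → Set
Type0 A L v = repCount A L v ≡ 0

Type1 : ∀ {n} → Digraph n → Labelling n → Fin n → Set
Type1 A L v = repCount A L v ≡ 1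

type0? : ∀ {n} (A : Digraph n) L v → Dec (Type0 A L v)
type0? A L v = repCount A L v Data.Nat.≟ 0

type1? : ∀ {n} (A : Digraph n) L v → Dec (Type1 A L v)
type1? A L v = repCount A L v Data.Nat.≟ 1

#type0 : ∀ {n} → Digraph n → Fin n → ℕ
#type0 {n} A v = length (filter (λ L → type0? A L v) (orderings n))

#type1 : ∀ {n} → Digraph n → Fin n → ℕ
#type1 {n} A v = length (filter (λ L → type1? A L v) (orderings n))

-- Let v be of type 1 under L, with u the only vertex such that r_L(u) = v, and let z be u
-- if u ≠ v and a fixed out-neighbour of v (≠ v, as there are no loops) otherwise; so z ≠ v,
-- z ∈ N⁺[u] and L(v) ≤ L(z).
-- Exchanging the labels of v and z only raises the label of v, so any vertex represented
-- by v afterwards was represented by v before, i.e. is u; but now z ∈ N⁺[u] has a smaller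
-- label than v, so v becomes of type 0. The map is injective: if L₁ and L₂ give the same
-- M with partners z₁, z₂ and M(z₁) ≤ M(z₂), then v still represents u₂ under L₁, so
-- u₂ = u₁, and z₁ ∈ N⁺[u₂] then forces M(z₂) ≤ M(z₁), hence z₁ = z₂.

module Submission where

open import Defs
open import Data.Nat using (ℕ; _≤_)
open import Data.Fin using (Fin)
open import Data.Bool using (true; false)
open import Data.Product using (∃)
open import Relation.Binary.PropositionalEquality using (_≡_)

open import Data.Nat using (zero; suc; z≤n; s≤s)
import Data.Nat.Properties as ℕ
import Data.Fin as F
open import Data.Fin using (_≟_)
open import Data.Fin.Properties using (≤-refl; ≤-antisym; ≤-total; ≤-poset)
open import Data.Fin.Permutation.Components using (transpose)
open import Data.Vec using (Vec; []; _∷_; lookup; tabulate)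
open import Data.Vec.Properties using (∷-injective; lookup∘tabulate; tabulate∘lookup; tabulate-cong)
open import Data.List
  using (List; []; _∷_; _++_; map; concatMap; filter; length; allFin; head; cartesianProductWith)
open import Data.List.Properties using (length-map; length-++-sucʳ; filter-none)
open import Data.List.Membership.Propositional using (_∈_)
open import Data.List.Membership.Propositional.Properties
open import Data.List.Relation.Binary.Subset.Propositional using (_⊆_)
open import Data.List.Relation.Unary.Any using (here; there)
import Data.List.Relation.Unary.All as All
open import Data.List.Relation.Unary.Unique.Propositional using (Unique; []; _∷_)
import Data.List.Relation.Unary.Unique.Propositional.Properties as Unique
open import Data.Maybe using (fromMaybe)
open import Data.Product using (_×_; _,_; proj₂)
open import Data.Sum using (inj₁; inj₂)
open import Data.Empty using (⊥-elim)
open import Function using (_∘_)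
open import Relation.Nullary using (¬_; Dec; yes; no)
open import Relation.Nullary.Decidable using (dec-true; dec-false)
open import Relation.Unary using (Pred; Decidable)
open import Relation.Binary.PropositionalEquality
  using (_≢_; refl; sym; trans; cong; subst; subst₂; module ≡-Reasoning)

module _ {a} {X : Set a} where

  Unique∧⊆⇒length≤ : ∀ {ys zs : List X} → Unique ys → ys ⊆ zs → length ys ≤ length zs
  Unique∧⊆⇒length≤ {[]} _ _ = z≤n
  Unique∧⊆⇒length≤ {y ∷ ys} (y∉ys ∷ uniq) ys⊆zs with ∈-∃++ (ys⊆zs (here refl))
  ... | as , bs , refl =
    ℕ.≤-trans (s≤s (Unique∧⊆⇒length≤ uniq ys⊆as++bs)) (ℕ.≤-reflexive (sym (length-++-sucʳ as y bs)))
    where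
    ys⊆as++bs : ys ⊆ as ++ bs
    ys⊆as++bs z∈ys with ∈-++⁻ as (ys⊆zs (there z∈ys))
    ... | inj₁ z∈as = ∈-++⁺ˡ z∈as
    ... | inj₂ (here refl) = ⊥-elim (All.lookup y∉ys z∈ys refl)
    ... | inj₂ (there z∈bs) = ∈-++⁺ʳ as z∈bs

  map⁺-injectiveOn : ∀ {b} {Y : Set b} {f : X → Y} {xs : List X} →
                     (∀ {x y} → x ∈ xs → y ∈ xs → f x ≡ f y → x ≡ y) →
                     Unique xs → Unique (map f xs)
  map⁺-injectiveOn {xs = []} _ [] = []
  map⁺-injectiveOn {f = f} {xs = x ∷ xs} inj (x∉xs ∷ uniq) =
    All.tabulate fx≢ ∷ map⁺-injectiveOn (λ p q → inj (there p) (there q)) uniq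
    where
    fx≢ : ∀ {y} → y ∈ map f xs → f x ≢ y
    fx≢ y∈ fx≡y with ∈-map⁻ f y∈
    ... | x′ , x′∈xs , refl = All.lookup x∉xs x′∈xs (inj (here refl) (there x′∈xs) fx≡y)

module _ {a b p q} {X : Set a} {Y : Set b} {P : Pred X p} {Q : Pred Y q} where

  length-filter-≤ : (P? : Decidable P) (Q? : Decidable Q) {xs : List X} {ys : List Y} (f : X → Y) →
                    Unique xs →
                    (∀ {x} → x ∈ xs → P x → f x ∈ ys × Q (f x)) →
                    (∀ {x y} → x ∈ xs → y ∈ xs → P x → P y → f x ≡ f y → x ≡ y) →
                    length (filter P? xs) ≤ length (filter Q? ys)
  length-filter-≤ P? Q? {xs} {ys} f uniq maps-to inj = begin
    length (filter P? xs)          ≡⟨ length-map f (filter P? xs) ⟨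
    length (map f (filter P? xs))  ≤⟨ Unique∧⊆⇒length≤ image-unique image⊆ ⟩
    length (filter Q? ys)          ∎
    where
    open ℕ.≤-Reasoning
    injP : ∀ {x y} → x ∈ filter P? xs → y ∈ filter P? xs → f x ≡ f y → x ≡ y
    injP x∈ y∈ with ∈-filter⁻ P? x∈ | ∈-filter⁻ P? y∈
    ... | x∈xs , Px | y∈xs , Py = inj x∈xs y∈xs Px Py
    image-unique : Unique (map f (filter P? xs))
    image-unique = map⁺-injectiveOn injP (Unique.filter⁺ P? uniq)
    image⊆ : map f (filter P? xs) ⊆ filter Q? ys
    image⊆ y∈ with ∈-map⁻ f y∈
    ... | x , x∈ , refl with ∈-filter⁻ P? x∈
    ... | x∈xs , Px = let (fx∈ys , Qfx) = maps-to x∈xs Px in ∈-filter⁺ Q? fx∈ys Qfx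

concatMap≡cartesianProductWith : ∀ {a b c} {X : Set a} {Y : Set b} {Z : Set c}
                                 (f : X → Y → Z) xs ys →
                                 concatMap (λ x → map (f x) ys) xs ≡ cartesianProductWith f xs ys
concatMap≡cartesianProductWith f [] ys = refl
concatMap≡cartesianProductWith f (x ∷ xs) ys =
  cong (map (f x) ys ++_) (concatMap≡cartesianProductWith f xs ys)

allVecs-unique : ∀ n k → Unique (allVecs n k)
allVecs-unique n zero = All.[] ∷ []
allVecs-unique n (suc k) =
  subst Unique (sym (concatMap≡cartesianProductWith _∷_ (allFin n) (allVecs n k)))
    (Unique.cartesianProductWith⁺ _∷_ ∷-injective (Unique.allFin⁺ n) (allVecs-unique n k))

∈-allVecs : ∀ n k (xs : Vec (Fin n) k) → xs ∈ allVecs n k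
∈-allVecs n zero [] = here refl
∈-allVecs n (suc k) (x ∷ xs) =
  subst (x ∷ xs ∈_) (sym (concatMap≡cartesianProductWith _∷_ (allFin n) (allVecs n k)))
    (∈-cartesianProductWith⁺ _∷_ (∈-allFin x) (∈-allVecs n k xs))

orderings-unique : ∀ n → Unique (orderings n)
orderings-unique n = Unique.filter⁺ isOrdering? (allVecs-unique n n)

∈-orderings⁺ : ∀ {n} {L : Labelling n} → IsOrdering L → L ∈ orderings n
∈-orderings⁺ {n} {L} = ∈-filter⁺ isOrdering? (∈-allVecs n n L)

∈-orderings⁻ : ∀ {n} {L : Labelling n} → L ∈ orderings n → IsOrdering L
∈-orderings⁻ {n} L∈ = proj₂ (∈-filter⁻ isOrdering? {xs = allVecs n n} L∈)

module _ {n : ℕ} where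

  transpose-matchˡ : ∀ (a b : Fin n) → transpose a b a ≡ b
  transpose-matchˡ a b rewrite dec-true (a ≟ a) refl = refl

  transpose-matchʳ : ∀ (a b : Fin n) → transpose a b b ≡ a
  transpose-matchʳ a b with b ≟ a
  ... | yes b≡a = b≡a
  ... | no _ rewrite dec-true (b ≟ b) refl = refl

  transpose-other : ∀ {a b x : Fin n} → x ≢ a → x ≢ b → transpose a b x ≡ x
  transpose-other {a} {b} {x} x≢a x≢b
    rewrite dec-false (x ≟ a) x≢a | dec-false (x ≟ b) x≢b = refl

  transpose-involutive : ∀ (a b x : Fin n) → transpose a b (transpose a b x) ≡ x
  transpose-involutive a b x = by-cases (x ≟ a) (x ≟ b)
    where
    by-cases : Dec (x ≡ a) → Dec (x ≡ b) → transpose a b (transpose a b x) ≡ x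
    by-cases (yes refl) _ = trans (cong (transpose x b) (transpose-matchˡ x b)) (transpose-matchʳ x b)
    by-cases (no _) (yes refl) = trans (cong (transpose a x) (transpose-matchʳ a x)) (transpose-matchˡ a x)
    by-cases (no x≢a) (no x≢b) =
      trans (cong (transpose a b) (transpose-other x≢a x≢b)) (transpose-other x≢a x≢b)

  swap : Labelling n → Fin n → Fin n → Labelling n
  swap L a b = tabulate (lookup L ∘ transpose a b)

  lookup-swap : ∀ L a b x → lookup (swap L a b) x ≡ lookup L (transpose a b x)
  lookup-swap L a b = lookup∘tabulate (lookup L ∘ transpose a b)

  lookup-swapˡ : ∀ L a b → lookup (swap L a b) a ≡ lookup L b
  lookup-swapˡ L a b = trans (lookup-swap L a b a) (cong (lookup L) (transpose-matchˡ a b))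

  lookup-swapʳ : ∀ L a b → lookup (swap L a b) b ≡ lookup L a
  lookup-swapʳ L a b = trans (lookup-swap L a b b) (cong (lookup L) (transpose-matchʳ a b))

  lookup-swap-other : ∀ L {a b x} → x ≢ a → x ≢ b → lookup (swap L a b) x ≡ lookup L x
  lookup-swap-other L {a} {b} {x} x≢a x≢b =
    trans (lookup-swap L a b x) (cong (lookup L) (transpose-other x≢a x≢b))

  swap-involutive : ∀ L a b → swap (swap L a b) a b ≡ L
  swap-involutive L a b = trans (tabulate-cong twice) (tabulate∘lookup L)
    where
    twice : ∀ x → lookup (swap L a b) (transpose a b x) ≡ lookup L x
    twice x = trans (lookup-swap L a b (transpose a b x)) (cong (lookup L) (transpose-involutive a b x))

  swap-isOrdering : ∀ L a b → IsOrdering L → IsOrdering (swap L a b)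
  swap-isOrdering L a b inj i j eq = begin
    i                               ≡⟨ transpose-involutive a b i ⟨
    transpose a b (transpose a b i) ≡⟨ cong (transpose a b) (inj _ _ labels≡) ⟩
    transpose a b (transpose a b j) ≡⟨ transpose-involutive a b j ⟩
    j                               ∎
    where
    open ≡-Reasoning
    labels≡ : lookup L (transpose a b i) ≡ lookup L (transpose a b j)
    labels≡ = trans (sym (lookup-swap L a b i)) (trans eq (lookup-swap L a b j))

module _ {n : ℕ} where
  open import Relation.Binary.Reasoning.PartialOrder (≤-poset n)

  _≤[_]_ : Fin n → Labelling n → Fin n → Set
  x ≤[ L ] y = lookup L x F.≤ lookup L y

  IsRep-mono : ∀ {A : Digraph n} {L L′ : Labelling n} {u w} →
               (∀ {x} → w ≤[ L′ ] x → w ≤[ L ] x) → IsRep A L′ u w → IsRep A L u w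
  IsRep-mono mono (w∈N , w-min) = w∈N , λ x x∈N → mono (w-min x x∈N)

  swap-≤-reflect : ∀ L {v z x} → v ≤[ L ] z → v ≤[ swap L v z ] x → v ≤[ L ] x
  swap-≤-reflect L {v} {z} {x} v≤z v≤x with x ≟ v | x ≟ z
  ... | yes refl | _ = ≤-refl
  ... | no _ | yes refl = v≤z
  ... | no x≢v | no x≢z = begin
    lookup L v            ≤⟨ v≤z ⟩
    lookup L z            ≡⟨ lookup-swapˡ L v z ⟨
    lookup (swap L v z) v ≤⟨ v≤x ⟩
    lookup (swap L v z) x ≡⟨ lookup-swap-other L x≢v x≢z ⟩
    lookup L x            ∎

  swap-≤-transfer : ∀ M {v z₁ z₂ x} → z₁ ≤[ M ] v → z₁ ≤[ M ] z₂ →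
                    v ≤[ swap M v z₂ ] x → v ≤[ swap M v z₁ ] x
  swap-≤-transfer M {v} {z₁} {z₂} {x} z₁≤v z₁≤z₂ v≤x with x ≟ v | x ≟ z₁ | x ≟ z₂
  ... | yes refl | _ | _ = ≤-refl
  ... | no _ | yes refl | _ = begin
    lookup (swap M v x) v ≡⟨ lookup-swapˡ M v x ⟩
    lookup M x            ≤⟨ z₁≤v ⟩
    lookup M v            ≡⟨ lookup-swapʳ M v x ⟨
    lookup (swap M v x) x ∎
  ... | no x≢v | no x≢z₁ | yes refl = begin
    lookup (swap M v z₁) v ≡⟨ lookup-swapˡ M v z₁ ⟩
    lookup M z₁            ≤⟨ z₁≤z₂ ⟩
    lookup M x             ≡⟨ lookup-swap-other M x≢v x≢z₁ ⟨
    lookup (swap M v z₁) x ∎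
  ... | no x≢v | no x≢z₁ | no x≢z₂ = begin
    lookup (swap M v z₁) v ≡⟨ lookup-swapˡ M v z₁ ⟩
    lookup M z₁            ≤⟨ z₁≤z₂ ⟩
    lookup M z₂            ≡⟨ lookup-swapˡ M v z₂ ⟨
    lookup (swap M v z₂) v ≤⟨ v≤x ⟩
    lookup (swap M v z₂) x ≡⟨ lookup-swap-other M x≢v x≢z₂ ⟩
    lookup M x             ≡⟨ lookup-swap-other M x≢v x≢z₁ ⟨
    lookup (swap M v z₁) x ∎

module _ {n : ℕ} (A : Digraph n) (v : Fin n) where

  represented : Labelling n → List (Fin n)
  represented L = filter (λ u → isRep? A L u v) (allFin n)

  firstRepresented : Labelling n → Fin n
  firstRepresented L = fromMaybe v (head (represented L))

  type1⇒represented≡ : ∀ L → Type1 A L v → represented L ≡ firstRepresented L ∷ []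
  type1⇒represented≡ L t with represented L | t
  ... | u ∷ [] | _ = refl

  type1⇒isRep : ∀ L → Type1 A L v → IsRep A L (firstRepresented L) v
  type1⇒isRep L t = proj₂ (∈-filter⁻ (λ u → isRep? A L u v) {xs = allFin n} first∈)
    where
    first∈ : firstRepresented L ∈ represented L
    first∈ = subst (firstRepresented L ∈_) (sym (type1⇒represented≡ L t)) (here refl)

  type1⇒sole : ∀ L {u} → Type1 A L v → IsRep A L u v → u ≡ firstRepresented L
  type1⇒sole L {u} t u-rep
    with subst (u ∈_) (type1⇒represented≡ L t) (∈-filter⁺ (λ u → isRep? A L u v) (∈-allFin u) u-rep)
  ... | here u≡first = u≡first

  noneRepresented⇒type0 : ∀ L → (∀ u → ¬ IsRep A L u v) → Type0 A L v
  noneRepresented⇒type0 L noRep =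
    cong length (filter-none (λ u → isRep? A L u v) (All.tabulate {xs = allFin n} (λ {u} _ → noRep u)))

  record Partner (L : Labelling n) (z : Fin n) : Set where
    constructor mkPartner
    field
      {preimage} : Fin n
      isRep : IsRep A L preimage v
      sole : ∀ {u} → IsRep A L u v → u ≡ preimage
      distinct : z ≢ v
      inNbhd : InClosedNbhd A preimage z

  swapped-rep-≤ : ∀ L {z t} → IsRep A (swap L v z) t v → InClosedNbhd A t z → z ≤[ L ] v
  swapped-rep-≤ L {z} (_ , v-min) z∈N⁺ =
    subst₂ F._≤_ (lookup-swapˡ L v z) (lookup-swapʳ L v z) (v-min z z∈N⁺)

  swap-partner-type0 : ∀ {L z} → IsOrdering L → Partner L z → Type0 A (swap L v z) v
  swap-partner-type0 {L} {z} inj (mkPartner u-rep u-sole z≢v z∈N⁺) =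
    noneRepresented⇒type0 (swap L v z) noRep
    where
    v≤z : v ≤[ L ] z
    v≤z = proj₂ u-rep z z∈N⁺
    noRep : ∀ t → ¬ IsRep A (swap L v z) t v
    noRep t t-rep
      with u-sole (IsRep-mono {A = A} {L = L} {L′ = swap L v z} (swap-≤-reflect L v≤z) t-rep)
    ... | refl = z≢v (inj z v (≤-antisym (swapped-rep-≤ L t-rep z∈N⁺) v≤z))

  partner-unique-≤ : ∀ {M z₁ z₂} → IsOrdering M →
                     Partner (swap M v z₁) z₁ → Partner (swap M v z₂) z₂ → z₁ ≤[ M ] z₂ → z₁ ≡ z₂
  partner-unique-≤ {M} {z₁} {z₂} inj (mkPartner rep₁ sole₁ z₁≢v z₁∈N⁺) (mkPartner rep₂ _ _ _) z₁≤z₂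
    with z₁ ≟ z₂
       | sole₁ (IsRep-mono {A = A} {L = swap M v z₁} {L′ = swap M v z₂}
                           (swap-≤-transfer M (swapped-rep-≤ M rep₁ z₁∈N⁺) z₁≤z₂) rep₂)
  ... | yes z₁≡z₂ | _ = z₁≡z₂
  ... | no z₁≢z₂ | refl = inj z₁ z₂ (≤-antisym z₁≤z₂ z₂≤z₁)
    where
    z₂≤z₁ : z₂ ≤[ M ] z₁
    z₂≤z₁ = subst₂ F._≤_ (lookup-swapˡ M v z₂) (lookup-swap-other M z₁≢v z₁≢z₂)
                         (proj₂ rep₂ z₁ z₁∈N⁺)

  partner-unique : ∀ {M z₁ z₂} → IsOrdering M →
                   Partner (swap M v z₁) z₁ → Partner (swap M v z₂) z₂ → z₁ ≡ z₂
  partner-unique {M} {z₁} {z₂} inj P₁ P₂ with ≤-total (lookup M z₁) (lookup M z₂)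
  ... | inj₁ z₁≤z₂ = partner-unique-≤ {M} inj P₁ P₂ z₁≤z₂
  ... | inj₂ z₂≤z₁ = sym (partner-unique-≤ {M} inj P₂ P₁ z₂≤z₁)

  swap-partner-injective : ∀ {L₁ L₂ z₁ z₂} → IsOrdering L₁ → Partner L₁ z₁ → Partner L₂ z₂ →
                           swap L₁ v z₁ ≡ swap L₂ v z₂ → L₁ ≡ L₂
  swap-partner-injective {L₁} {L₂} {z₁} {z₂} L₁-inj P₁ P₂ eq = begin
    L₁          ≡⟨ unswap₁ ⟨
    swap M v z₁ ≡⟨ cong (swap M v) z₁≡z₂ ⟩
    swap M v z₂ ≡⟨ unswap₂ ⟩
    L₂          ∎
    where
    open ≡-Reasoning
    M : Labelling n
    M = swap L₁ v z₁
    unswap₁ : swap M v z₁ ≡ L₁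
    unswap₁ = swap-involutive L₁ v z₁
    unswap₂ : swap M v z₂ ≡ L₂
    unswap₂ = trans (cong (λ K → swap K v z₂) eq) (swap-involutive L₂ v z₂)
    z₁≡z₂ : z₁ ≡ z₂
    z₁≡z₂ = partner-unique {M} (swap-isOrdering L₁ v z₁ L₁-inj)
      (subst (λ K → Partner K z₁) (sym unswap₁) P₁) (subst (λ K → Partner K z₂) (sym unswap₂) P₂)

module _ {n : ℕ} (A : Digraph n) {v w₀ : Fin n} (v→w₀ : A v w₀ ≡ true) (w₀≢v : w₀ ≢ v) where

  partnerOf : Fin n → Fin n
  partnerOf u with u ≟ v
  ... | yes _ = w₀
  ... | no _ = u

  partnerOf-≢ : ∀ u → partnerOf u ≢ v
  partnerOf-≢ u with u ≟ v
  ... | yes _ = w₀≢v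
  ... | no u≢v = u≢v

  partnerOf-∈N⁺ : ∀ u → InClosedNbhd A u (partnerOf u)
  partnerOf-∈N⁺ u with u ≟ v
  ... | yes refl = inj₂ v→w₀
  ... | no _ = inj₁ refl

  swapPartner : Labelling n → Labelling n
  swapPartner L = swap L v (partnerOf (firstRepresented A v L))

  swapPartner-isOrdering : ∀ L → IsOrdering L → IsOrdering (swapPartner L)
  swapPartner-isOrdering L = swap-isOrdering L v (partnerOf (firstRepresented A v L))

  type1⇒Partner : ∀ L → Type1 A L v → Partner A v L (partnerOf (firstRepresented A v L))
  type1⇒Partner L t =
    mkPartner (type1⇒isRep A v L t) (type1⇒sole A v L t)
              (partnerOf-≢ (firstRepresented A v L)) (partnerOf-∈N⁺ (firstRepresented A v L))

  #type1≤#type0 : #type1 A v ≤ #type0 A v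
  #type1≤#type0 =
    length-filter-≤ (λ L → type1? A L v) (λ L → type0? A L v) swapPartner
                    (orderings-unique n) maps-to injective
    where
    maps-to : ∀ {L} → L ∈ orderings n → Type1 A L v →
              swapPartner L ∈ orderings n × Type0 A (swapPartner L) v
    maps-to {L} L∈ t = ∈-orderings⁺ (swapPartner-isOrdering L (∈-orderings⁻ L∈)) ,
                       swap-partner-type0 A v (∈-orderings⁻ L∈) (type1⇒Partner L t)
    injective : ∀ {L₁ L₂} → L₁ ∈ orderings n → L₂ ∈ orderings n → Type1 A L₁ v → Type1 A L₂ v →
                swapPartner L₁ ≡ swapPartner L₂ → L₁ ≡ L₂
    injective {L₁} {L₂} L₁∈ _ t₁ t₂ =
      swap-partner-injective A v (∈-orderings⁻ L₁∈) (type1⇒Partner L₁ t₁) (type1⇒Partner L₂ t₂)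

lemma1 : (n : ℕ) (A : Digraph n)
         → (∀ u → A u u ≡ false)
         → (v : Fin n)
         → ∃ (λ u → A v u ≡ true)
         → #type1 A v ≤ #type0 A v
lemma1 n A irreflexive v (w₀ , v→w₀) = #type1≤#type0 A v→w₀ w₀≢v
  where
  w₀≢v : w₀ ≢ v
  w₀≢v refl with trans (sym v→w₀) (irreflexive v)
  ... | ()
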